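{- Let $k$ be an integer and $c \in \mathbb{Z}^d$, and assume the LP $\mathcal{P}$ is feasible. Then there exists an optimal solution $\hat w$ of $\mathcal{D}$ with $\hat w_0 \in \mathbb{Z}$.
   Context: $\Delta$ is a positive integer. $\mathcal{P}$: maximize $c^T u$ subject to $\sum_{i=1}^d u_i = k$, $\sum_{j=i}^{\min\{i+\Delta-1,d\}} u_j \le 1$ for all $i=1,\dots,d$, $u_i \ge 0$. $\mathcal{D}$ (its dual) is the LP in variables $w_0 \in \mathbb{R}$, $w_1,\dots,w_d$: minimize $w_0 k + \sum_{i=1}^d w_i$ subject to $w_0 + \sum_{j : j \ge 1,\ j \le i \le j+\Delta-1} w_j \ge c_i$ for $i=1,\dots,d$, and $w_i \ge 0$ for $i=1,\dots,d$.
   Formalization: The variables of the LPs $\mathcal{P}$ and $\mathcal{D}$, including $w_0$, take values in ℚ rather than ℝ. -}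

module Defs where

open import Data.Nat using (ℕ; zero; suc; _≤ᵇ_; _<ᵇ_) renaming (_+_ to _+ℕ_)
open import Data.Bool using (Bool; if_then_else_; _∧_)
open import Data.Fin using (Fin; toℕ) renaming (zero to fz; suc to fs)
open import Data.Integer using (ℤ)
open import Data.Rational using (ℚ; 0ℚ; 1ℚ; _+_; _*_; _≤_; _/_)
open import Data.Product using (Σ; _×_)
open import Relation.Binary.PropositionalEquality using (_≡_)

ι : ℤ → ℚ
ι z = z / 1

sumℚ : ∀ {n} → (Fin n → ℚ) → ℚ
sumℚ {zero}  f = 0ℚ
sumℚ {suc n} f = f fz + sumℚ (λ j → f (fs j))

sumWhere : ∀ {n} → (Fin n → Bool) → (Fin n → ℚ) → ℚ
sumWhere p f = sumℚ (λ j → if p j then f j else 0ℚ)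

-- 0-based indices: index i (Fin d) corresponds to paper index i+1.
-- inWindow Δ i j  ⇔  i ≤ j ≤ i + Δ - 1
inWindow : ∀ {d} → ℕ → Fin d → Fin d → Bool
inWindow Δ i j = (toℕ i ≤ᵇ toℕ j) ∧ (toℕ j <ᵇ toℕ i +ℕ Δ)

PFeasible : (d Δ : ℕ) (k : ℤ) → (Fin d → ℚ) → Set
PFeasible d Δ k u =
  sumℚ u ≡ ι k ×
  ((i : Fin d) → sumWhere (inWindow Δ i) u ≤ 1ℚ) ×
  ((i : Fin d) → 0ℚ ≤ u i)

DFeasible : (d Δ : ℕ) (c : Fin d → ℤ) → ℚ → (Fin d → ℚ) → Set
DFeasible d Δ c w₀ w =
  ((i : Fin d) → ι (c i) ≤ w₀ + sumWhere (λ j → inWindow Δ j i) w) ×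
  ((i : Fin d) → 0ℚ ≤ w i)

DObj : (d : ℕ) (k : ℤ) → ℚ → (Fin d → ℚ) → ℚ
DObj d k w₀ w = w₀ * ι k + sumℚ w

DOptimal : (d Δ : ℕ) (k : ℤ) (c : Fin d → ℤ) → ℚ → (Fin d → ℚ) → Set
DOptimal d Δ k c w₀ w =
  DFeasible d Δ c w₀ w ×
  ((v₀ : ℚ) (v : Fin d → ℚ) → DFeasible d Δ c v₀ v → DObj d k w₀ w ≤ DObj d k v₀ v)

module Submission where

-- Positions are 0-based.  A packing of [0,n) is a set of positions below n
-- with pairwise distance at least Δ; packings are the integral points of P.
--  (1) Primal bound.  Walking down the windows of P, a feasible u has
--      u₀ + … + u_{n-1} ≤ M(n), the largest size of a packing of [0,n).
--      Hence k = m is a natural number with m ≤ M(d).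
--  (2) Exchange.  If packings satisfy |A| > |B|, one position can be moved from
--      A to B keeping the total weight.  So the best weight h(κ) of a size-κ
--      packing is concave, and λ = h(m) − h(m−1) ∈ ℤ is a Lagrange multiplier:
--      a best size-m packing T maximises the (c − λ)-weight over ALL packings.
--  (3) Dual certificate.  Let W(n) be the best (c − λ)-weight of a packing of
--      [0,n).  Then w₀ = λ, w_j = W(j+1) − W(j) is dual feasible, because
--      W(i+1) ≥ c_i − λ + W(i+1−Δ), and its objective is λm + W(d) = c(T).
--  (4) Weak duality.  Summing the dual constraints along T shows that every
--      dual feasible point has objective at least c(T); so (λ, w) is optimal.
-- The file first collects arithmetic of ι : ℤ → ℚ and of prefix sums, expresses
-- the window sums of P and D through prefix sums, then develops packings
-- (exchange lemma, maximisers), and proves (1) in PrimalBound, (2) in Lagrange,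
-- (3) and (4) in DualCertificate; corollary2 combines them.  In the code the
-- multiplier λ is called μ.

open import Defs
open import Data.Nat using (ℕ; _≥_)
open import Data.Fin using (Fin)
open import Data.Integer using (ℤ)
open import Data.Rational using (ℚ)
open import Data.Product using (Σ; _×_)
open import Relation.Binary.PropositionalEquality using (_≡_)

open import Data.Nat as N using (zero; suc; _∸_; _⊓_; z≤n; s≤s; _≤ᵇ_; _<ᵇ_)
import Data.Nat.Properties as NP
import Data.Nat.Coprimality as Coprime
open import Data.Integer as Z using (+_; -[1+_]; +≤+)
import Data.Integer.Properties as ZP
open import Data.Integer.Tactic.RingSolver using (solve-∀)
open import Data.Rational as Q using (0ℚ; 1ℚ; mkℚ; *≤*)
import Data.Rational.Properties as QP
open import Data.Rational.Solver using (module +-*-Solver)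
open import Algebra.Properties.Group QP.+-0-group using (identityˡ-unique)
open import Data.Bool using (Bool; true; false; if_then_else_; T; _∧_)
open import Data.Bool.Properties using (T-∧)
import Data.Fin as F
import Data.Fin.Properties as FP
open import Data.List using (List; []; _∷_; length; _++_; map; filter)
open import Data.List.Relation.Unary.All using (lookup)
open import Data.List.Relation.Unary.All.Properties using (all-filter)
open import Data.List.Relation.Unary.Any using (here)
open import Data.List.Membership.Propositional using (_∈_)
open import Data.List.Membership.Propositional.Properties using (∈-++⁺ˡ; ∈-++⁺ʳ; ∈-map⁺; ∈-filter⁺)
open import Data.List.Extrema ZP.≤-totalOrder using (argmax; argmax-all; f[xs]≤f[argmax])
open import Data.Unit using (⊤; tt)
open import Data.Empty using (⊥-elim)
open import Data.Product using (_,_; proj₁; proj₂)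
open import Function.Bundles using (Equivalence)
open import Relation.Nullary using (Dec; yes; no)
open import Relation.Nullary.Decidable using (_×-dec_)
open import Relation.Binary.PropositionalEquality using (refl; sym; trans; cong; cong₂; subst; subst₂; module ≡-Reasoning)

open F using (toℕ; fromℕ<)
open Equivalence using (to; from)

-- z / 1 is already in lowest terms, so ι z has z as numerator and 1 as denominator.
ι-mkℚ : ∀ z → ι z ≡ mkℚ z 0 (Coprime.sym (Coprime.1-coprimeTo Z.∣ z ∣))
ι-mkℚ (+ n)    = QP.normalize-coprime (Coprime.sym (Coprime.1-coprimeTo n))
ι-mkℚ -[1+ n ] = cong Q.-_ (QP.normalize-coprime (Coprime.sym (Coprime.1-coprimeTo (suc n))))

ι-+ : ∀ a b → ι (a Z.+ b) ≡ ι a Q.+ ι b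
ι-+ a b = trans (cong ι (sym (cong₂ Z._+_ (ZP.*-identityʳ a) (ZP.*-identityʳ b))))
                (sym (cong₂ Q._+_ (ι-mkℚ a) (ι-mkℚ b)))

ι-* : ∀ a b → ι (a Z.* b) ≡ ι a Q.* ι b
ι-* a b = sym (cong₂ Q._*_ (ι-mkℚ a) (ι-mkℚ b))

ι-mono : ∀ {a b} → a Z.≤ b → ι a Q.≤ ι b
ι-mono {a} {b} a≤b rewrite ι-mkℚ a | ι-mkℚ b =
  *≤* (subst₂ Z._≤_ (sym (ZP.*-identityʳ a)) (sym (ZP.*-identityʳ b)) a≤b)

ι-cancel-≤ : ∀ {a b} → ι a Q.≤ ι b → a Z.≤ b
ι-cancel-≤ {a} {b} ιa≤ιb rewrite ι-mkℚ a | ι-mkℚ b with ιa≤ιb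
... | *≤* a≤b = subst₂ Z._≤_ (ZP.*-identityʳ a) (ZP.*-identityʳ b) a≤b

two-bounded : ∀ {x y s t : ℤ} → x Z.+ y ≡ s Z.+ t → x Z.≤ t → y Z.≤ t → s Z.≤ t
two-bounded {x} {y} {s} {t} x+y≡s+t x≤t y≤t = begin
  s                   ≡⟨ sym (plus-minus s t) ⟩
  (s Z.+ t) Z.- t     ≡⟨ cong (Z._- t) (sym x+y≡s+t) ⟩
  (x Z.+ y) Z.- t     ≤⟨ ZP.+-monoˡ-≤ (Z.- t) (ZP.+-mono-≤ x≤t y≤t) ⟩
  (t Z.+ t) Z.- t     ≡⟨ plus-minus t t ⟩
  t                   ∎
  where
  open ZP.≤-Reasoning
  plus-minus : ∀ (a b : ℤ) → (a Z.+ b) Z.- b ≡ a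
  plus-minus = solve-∀

bounded-nat : ∀ {k : ℤ} {M : ℕ} → + 0 Z.≤ k → k Z.≤ + M → Σ ℕ λ m → k ≡ + m × m N.≤ M
bounded-nat {+ m}     _  (+≤+ m≤M) = m , refl , m≤M
bounded-nat { -[1+ _ ]} () _

+-cancelʳ-≤ : ∀ {a b} c → a Q.+ c Q.≤ b Q.+ c → a Q.≤ b
+-cancelʳ-≤ {a} {b} c le =
  subst₂ Q._≤_ (plus-minus a c) (plus-minus b c) (QP.+-monoˡ-≤ (Q.- c) le)
  where
  open +-*-Solver
  plus-minus : ∀ x y → (x Q.+ y) Q.- y ≡ x
  plus-minus = solve 2 (λ x y → (x :+ y) :- y := x) refl

-- Prefix sums of ℕ-indexed sequences

psum : ℕ → (ℕ → ℚ) → ℚ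
psum zero    g = 0ℚ
psum (suc n) g = psum n g Q.+ g n

-- Peeling off the first summand; this is how the Fin-indexed sumℚ recurses.
psum-suc : ∀ n (g : ℕ → ℚ) → psum (suc n) g ≡ g 0 Q.+ psum n (λ i → g (suc i))
psum-suc zero    g = trans (QP.+-identityˡ (g 0)) (sym (QP.+-identityʳ (g 0)))
psum-suc (suc n) g = trans (cong (Q._+ g (suc n)) (psum-suc n g)) (QP.+-assoc (g 0) _ _)

sumℚ≡psum : ∀ {d} (h : Fin d → ℚ) (g : ℕ → ℚ) → (∀ j → h j ≡ g (toℕ j)) → sumℚ h ≡ psum d g
sumℚ≡psum {zero}  h g h≡g = refl
sumℚ≡psum {suc d} h g h≡g =
  trans (cong₂ Q._+_ (h≡g F.zero) (sumℚ≡psum (λ j → h (F.suc j)) (λ i → g (suc i)) (λ j → h≡g (F.suc j))))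
        (sym (psum-suc d g))

psum-mono : ∀ (g : ℕ → ℚ) → (∀ i → 0ℚ Q.≤ g i) → ∀ {m n} → m N.≤ n → psum m g Q.≤ psum n g
psum-mono g g≥0 {n = zero}  z≤n = QP.≤-refl
psum-mono g g≥0 {m} {suc n} m≤1+n with m N.≟ suc n
... | yes refl = QP.≤-refl
... | no  m≢   = QP.≤-trans (psum-mono g g≥0 (N.s≤s⁻¹ (NP.≤∧≢⇒< m≤1+n m≢)))
                            (subst (Q._≤ psum (suc n) g) (QP.+-identityʳ (psum n g))
                                   (QP.+-monoʳ-≤ (psum n g) (g≥0 n)))

psum-nonneg : ∀ (g : ℕ → ℚ) → (∀ i → 0ℚ Q.≤ g i) → ∀ n → 0ℚ Q.≤ psum n g
psum-nonneg g g≥0 n = psum-mono g g≥0 {0} {n} z≤n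

restrict : (ℕ → Bool) → (ℕ → ℚ) → ℕ → ℚ
restrict p g j = if p j then g j else 0ℚ

⊓-stable : ∀ {l n} → l N.≤ n → suc n ⊓ l ≡ n ⊓ l
⊓-stable l≤n = trans (NP.m≥n⇒m⊓n≡n (NP.m≤n⇒m≤1+n l≤n)) (sym (NP.m≥n⇒m⊓n≡n l≤n))

psum-interval : ∀ (p : ℕ → Bool) (g : ℕ → ℚ) {l r} → l N.≤ r →
  (∀ j → T (p j) → l N.≤ j × j N.< r) → (∀ j → l N.≤ j → j N.< r → T (p j)) →
  ∀ n → psum n (restrict p g) Q.+ psum (n ⊓ l) g ≡ psum (n ⊓ r) g
psum-interval p g l≤r sound complete zero = refl
psum-interval p g {l} {r} l≤r sound complete (suc n) with p n in pn
... | true = begin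
    (R n Q.+ g n) Q.+ psum (suc n ⊓ l) g ≡⟨ cong (λ t → (R n Q.+ g n) Q.+ psum t g) (⊓-stable l≤n) ⟩
    (R n Q.+ g n) Q.+ psum (n ⊓ l) g     ≡⟨ swap (R n) (g n) (psum (n ⊓ l) g) ⟩
    (R n Q.+ psum (n ⊓ l) g) Q.+ g n     ≡⟨ cong (Q._+ g n) (psum-interval p g l≤r sound complete n) ⟩
    psum (n ⊓ r) g Q.+ g n               ≡⟨ cong (λ t → psum t g Q.+ g n) (NP.m≤n⇒m⊓n≡m (NP.<⇒≤ n<r)) ⟩
    psum (suc n) g                       ≡⟨ cong (λ t → psum t g) (sym (NP.m≤n⇒m⊓n≡m n<r)) ⟩
    psum (suc n ⊓ r) g                   ∎
  where
  open ≡-Reasoning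
  open +-*-Solver
  R : ℕ → ℚ
  R m = psum m (restrict p g)
  l≤n = proj₁ (sound n (subst T (sym pn) tt))
  n<r = proj₂ (sound n (subst T (sym pn) tt))
  swap : ∀ a b c → (a Q.+ b) Q.+ c ≡ (a Q.+ c) Q.+ b
  swap = solve 3 (λ a b c → (a :+ b) :+ c := (a :+ c) :+ b) refl
... | false with n N.<? l
...   | yes n<l = begin
    (R n Q.+ 0ℚ) Q.+ psum (suc n ⊓ l) g ≡⟨ cong₂ (λ a t → (a Q.+ 0ℚ) Q.+ psum t g) R≡0 (NP.m≤n⇒m⊓n≡m n<l) ⟩
    0ℚ Q.+ psum (suc n) g               ≡⟨ QP.+-identityˡ (psum (suc n) g) ⟩
    psum (suc n) g                      ≡⟨ cong (λ t → psum t g) (sym (NP.m≤n⇒m⊓n≡m (NP.≤-trans n<l l≤r))) ⟩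
    psum (suc n ⊓ r) g                  ∎
  where
  open ≡-Reasoning
  R : ℕ → ℚ
  R m = psum m (restrict p g)
  -- below l nothing has been collected yet
  R≡0 : R n ≡ 0ℚ
  R≡0 = identityˡ-unique (R n) (psum n g)
    (subst₂ (λ a b → R n Q.+ psum a g ≡ psum b g)
            (NP.m≤n⇒m⊓n≡m (NP.<⇒≤ n<l)) (NP.m≤n⇒m⊓n≡m (NP.<⇒≤ (NP.<-≤-trans n<l l≤r)))
            (psum-interval p g l≤r sound complete n))
...   | no n≮l with n N.<? r
...     | yes n<r = ⊥-elim (subst T pn (complete n (NP.≮⇒≥ n≮l) n<r))
...     | no n≮r = begin
    (R n Q.+ 0ℚ) Q.+ psum (suc n ⊓ l) g ≡⟨ cong₂ (λ a t → a Q.+ psum t g) (QP.+-identityʳ (R n)) (⊓-stable (NP.≮⇒≥ n≮l)) ⟩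
    R n Q.+ psum (n ⊓ l) g              ≡⟨ psum-interval p g l≤r sound complete n ⟩
    psum (n ⊓ r) g                      ≡⟨ cong (λ t → psum t g) (sym (⊓-stable (NP.≮⇒≥ n≮r))) ⟩
    psum (suc n ⊓ r) g                  ∎
  where
  open ≡-Reasoning
  R : ℕ → ℚ
  R m = psum m (restrict p g)

ι-telescope : (F : ℕ → ℤ) → F 0 ≡ + 0 → ∀ n → psum n (λ i → ι (F (suc i) Z.- F i)) ≡ ι (F n)
ι-telescope F F₀≡0 zero    = cong ι (sym F₀≡0)
ι-telescope F F₀≡0 (suc n) = begin
  psum n (λ i → ι (F (suc i) Z.- F i)) Q.+ ι (F (suc n) Z.- F n) ≡⟨ cong (Q._+ ι (F (suc n) Z.- F n)) (ι-telescope F F₀≡0 n) ⟩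
  ι (F n) Q.+ ι (F (suc n) Z.- F n)                              ≡⟨ sym (ι-+ (F n) _) ⟩
  ι (F n Z.+ (F (suc n) Z.- F n))                                ≡⟨ cong ι (cancel (F n) (F (suc n))) ⟩
  ι (F (suc n))                                                  ∎
  where
  open ≡-Reasoning
  cancel : ∀ (a b : ℤ) → a Z.+ (b Z.- a) ≡ b
  cancel = solve-∀

extend : ∀ {A : Set} {d} → A → (Fin d → A) → ℕ → A
extend {d = d} a f n with n N.<? d
... | yes n<d = f (fromℕ< n<d)
... | no  _   = a

extend-toℕ : ∀ {A : Set} {d} (a : A) (f : Fin d → A) (j : Fin d) → extend a f (toℕ j) ≡ f j
extend-toℕ {d = d} a f j with toℕ j N.<? d
... | yes j<d = cong f (FP.fromℕ<-toℕ j j<d)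
... | no  j≮d = ⊥-elim (j≮d (FP.toℕ<n j))

extend-all : ∀ {A : Set} {d} (P : A → Set) {a : A} {f : Fin d → A} →
  P a → (∀ j → P (f j)) → ∀ n → P (extend a f n)
extend-all {d = d} P Pa Pf n with n N.<? d
... | yes n<d = Pf (fromℕ< n<d)
... | no  _   = Pa

-- Window sums as differences of prefix sums

position : ∀ {d} x → x N.< d → Σ (Fin d) λ i → toℕ i ≡ x
position x x<d = fromℕ< x<d , FP.toℕ-fromℕ< x<d

restrict-extension : ∀ {d} (p : ℕ → Bool) (v : Fin d → ℚ) (g : ℕ → ℚ) → (∀ j → v j ≡ g (toℕ j)) →
  ∀ j → (if p (toℕ j) then v j else 0ℚ) ≡ restrict p g (toℕ j)
restrict-extension p v g v≡g j with p (toℕ j)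
... | true  = v≡g j
... | false = refl

module Windows (Δ : ℕ) where

  window-sum : ∀ {d} (i : Fin d) (v : Fin d → ℚ) (g : ℕ → ℚ) → (∀ j → v j ≡ g (toℕ j)) →
    sumWhere (inWindow Δ i) v Q.+ psum (toℕ i) g ≡ psum (d ⊓ (toℕ i N.+ Δ)) g
  window-sum {d} i v g v≡g = begin
    sumWhere (inWindow Δ i) v Q.+ psum (toℕ i) g  ≡⟨ cong₂ Q._+_ (sumℚ≡psum _ (restrict p g) (restrict-extension p v g v≡g))
                                                                  (cong (λ t → psum t g) (sym (NP.m≥n⇒m⊓n≡n (NP.<⇒≤ (FP.toℕ<n i))))) ⟩
    psum d (restrict p g) Q.+ psum (d ⊓ toℕ i) g ≡⟨ psum-interval p g (NP.m≤m+n (toℕ i) Δ) sound complete d ⟩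
    psum (d ⊓ (toℕ i N.+ Δ)) g                    ∎
    where
    open ≡-Reasoning
    p : ℕ → Bool
    p j = (toℕ i ≤ᵇ j) ∧ (j <ᵇ toℕ i N.+ Δ)
    sound : ∀ j → T (p j) → toℕ i N.≤ j × j N.< toℕ i N.+ Δ
    sound j t = NP.≤ᵇ⇒≤ (toℕ i) j (proj₁ (to T-∧ t)) , NP.<ᵇ⇒< j (toℕ i N.+ Δ) (proj₂ (to T-∧ t))
    complete : ∀ j → toℕ i N.≤ j → j N.< toℕ i N.+ Δ → T (p j)
    complete j i≤j j<i+Δ = from T-∧ (NP.≤⇒≤ᵇ i≤j , NP.<⇒<ᵇ j<i+Δ)

  cover-sum : ∀ {d} (i : Fin d) (v : Fin d → ℚ) (g : ℕ → ℚ) → (∀ j → v j ≡ g (toℕ j)) →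
    sumWhere (λ j → inWindow Δ j i) v Q.+ psum (suc (toℕ i) ∸ Δ) g ≡ psum (suc (toℕ i)) g
  cover-sum {d} i v g v≡g = begin
    sumWhere (λ j → inWindow Δ j i) v Q.+ psum l g ≡⟨ cong₂ Q._+_ (sumℚ≡psum _ (restrict p g) (restrict-extension p v g v≡g))
                                                                  (cong (λ t → psum t g) (sym (NP.m≥n⇒m⊓n≡n (NP.≤-trans l≤r r≤d)))) ⟩
    psum d (restrict p g) Q.+ psum (d ⊓ l) g      ≡⟨ psum-interval p g l≤r sound complete d ⟩
    psum (d ⊓ r) g                                ≡⟨ cong (λ t → psum t g) (NP.m≥n⇒m⊓n≡n r≤d) ⟩
    psum r g                                      ∎
    where
    open ≡-Reasoning
    l r : ℕ
    l = suc (toℕ i) ∸ Δ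
    r = suc (toℕ i)
    l≤r : l N.≤ r
    l≤r = NP.m∸n≤m r Δ
    r≤d : r N.≤ d
    r≤d = FP.toℕ<n i
    p : ℕ → Bool
    p j = (j ≤ᵇ toℕ i) ∧ (toℕ i <ᵇ j N.+ Δ)
    sound : ∀ j → T (p j) → l N.≤ j × j N.< r
    sound j t = NP.m≤n+o⇒m∸n≤o r Δ (subst (r N.≤_) (NP.+-comm j Δ) (NP.<ᵇ⇒< (toℕ i) (j N.+ Δ) (proj₂ (to T-∧ t))))
              , s≤s (NP.≤ᵇ⇒≤ j (toℕ i) (proj₁ (to T-∧ t)))
    complete : ∀ j → l N.≤ j → j N.< r → T (p j)
    complete j l≤j j<r = from T-∧ (NP.≤⇒≤ᵇ (N.s≤s⁻¹ j<r) , NP.<⇒<ᵇ i<j+Δ)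
      where
      i<j+Δ : r N.≤ j N.+ Δ
      i<j+Δ = NP.≤-trans (NP.m≤n+m∸n r Δ) (subst (N._≤ j N.+ Δ) (NP.+-comm l Δ) (NP.+-monoˡ-≤ Δ l≤j))

-- Packings: sets of positions at mutual distance at least Δ
module Packings (Δ : ℕ) (Δ≥1 : Δ ≥ 1) where

  -- Packing i xs: xs lists positions below i in decreasing order; after choosing
  -- x, the remaining positions lie below suc x ∸ Δ, i.e. at distance ≥ Δ from x.
  Packing : ℕ → List ℕ → Set
  Packing i []       = ⊤
  Packing i (x ∷ xs) = x N.< i × Packing (suc x ∸ Δ) xs

  packing? : ∀ i xs → Dec (Packing i xs)
  packing? i []       = yes tt
  packing? i (x ∷ xs) = (x N.<? i) ×-dec packing? (suc x ∸ Δ) xs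

  packing-mono : ∀ {i j} xs → i N.≤ j → Packing i xs → Packing j xs
  packing-mono []       i≤j p         = tt
  packing-mono (x ∷ xs) i≤j (x<i , p) = NP.≤-trans x<i i≤j , p

  -- Because Δ ≥ 1, the bound for the rest of a packing drops strictly below x.
  below-next : ∀ x → suc x ∸ Δ N.≤ x
  below-next x = NP.m≤n+o⇒m∸n≤o (suc x) Δ (NP.+-monoˡ-≤ x Δ≥1)

  packing-tail : ∀ {i} x xs → Packing i (x ∷ xs) → Packing i xs
  packing-tail x xs (x<i , p) = packing-mono xs (NP.≤-trans (below-next x) (NP.<⇒≤ x<i)) p

  weight : (ℕ → ℤ) → List ℕ → ℤ
  weight f []       = + 0
  weight f (x ∷ xs) = f x Z.+ weight f xs

  -- The outcome of moving one position from the longer packing A to B.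
  record Exchange (f : ℕ → ℤ) (i j : ℕ) (A B : List ℕ) : Set where
    field
      A′ B′      : List ℕ
      A′-packing : Packing j A′
      B′-packing : Packing i B′
      A′-length  : suc (length A′) ≡ length A
      B′-length  : length B′ ≡ suc (length B)
      balance    : weight f A′ Z.+ weight f B′ ≡ weight f A Z.+ weight f B

  rest-fits : ∀ {x i j} → x N.< i → i N.≤ j N.+ Δ → suc x ∸ Δ N.≤ j
  rest-fits {x} {i} {j} x<i i≤j+Δ =
    NP.m≤n+o⇒m∸n≤o (suc x) Δ (subst (suc x N.≤_) (NP.+-comm j Δ) (NP.≤-trans x<i i≤j+Δ))

  -- Scan both packings from the top: as long as the heads are
  -- closer than Δ, swap the two tails; at the first gap of ≥ Δ (or when B runs
  -- out), the head of A can be prepended to B.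
  exchange : ∀ (f : ℕ → ℤ) {i j} A B → Packing i A → Packing j B → i N.≤ j N.+ Δ →
    length B N.< length A → Exchange f i j A B
  exchange f [] B pA pB i≤j+Δ ()
  exchange f (x ∷ A) [] (x<i , pA) pB i≤j+Δ _ = record
    { A′ = A ; B′ = x ∷ []
    ; A′-packing = packing-mono A (rest-fits x<i i≤j+Δ) pA ; B′-packing = x<i , tt
    ; A′-length = refl ; B′-length = refl ; balance = rearrange (f x) (weight f A) }
    where
    rearrange : ∀ (a b : ℤ) → b Z.+ (a Z.+ + 0) ≡ (a Z.+ b) Z.+ + 0
    rearrange = solve-∀
  exchange f (x ∷ A) (y ∷ B) (x<i , pA) (y<j , pB) i≤j+Δ lt with (y N.+ Δ) N.≤? x
  ... | yes y+Δ≤x = record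
    { A′ = A ; B′ = x ∷ y ∷ B
    ; A′-packing = packing-mono A (rest-fits x<i i≤j+Δ) pA
    ; B′-packing = x<i , NP.m+n≤o⇒m≤o∸n (suc y) (s≤s y+Δ≤x) , pB
    ; A′-length = refl ; B′-length = refl
    ; balance = rearrange (f x) (weight f (y ∷ B)) (weight f A) }
    where
    rearrange : ∀ (a b c : ℤ) → c Z.+ (a Z.+ b) ≡ (a Z.+ c) Z.+ b
    rearrange = solve-∀
  ... | no y+Δ≰x = record
    { A′ = y ∷ R.A′ ; B′ = x ∷ R.B′
    ; A′-packing = y<j , R.A′-packing ; B′-packing = x<i , R.B′-packing
    ; A′-length = cong suc R.A′-length ; B′-length = cong suc R.B′-length
    ; balance = begin
        (f y Z.+ weight f R.A′) Z.+ (f x Z.+ weight f R.B′) ≡⟨ regroup (f y) (f x) (weight f R.A′) (weight f R.B′) ⟩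
        (f y Z.+ f x) Z.+ (weight f R.A′ Z.+ weight f R.B′) ≡⟨ cong (λ t → (f y Z.+ f x) Z.+ t) R.balance ⟩
        (f y Z.+ f x) Z.+ (weight f A Z.+ weight f B)       ≡⟨ interleave (f y) (f x) (weight f A) (weight f B) ⟩
        (f x Z.+ weight f A) Z.+ (f y Z.+ weight f B)       ∎ }
    where
    open ≡-Reasoning
    -- x lies within Δ of y, so the tail bounds satisfy the hypothesis again
    tails-close : suc x ∸ Δ N.≤ (suc y ∸ Δ) N.+ Δ
    tails-close = NP.≤-trans
      (NP.m≤n+o⇒m∸n≤o (suc x) Δ (subst (suc x N.≤_) (trans (cong suc (NP.+-comm y Δ)) (sym (NP.+-suc Δ y)))
                                                    (NP.m≤n⇒m≤1+n (NP.≰⇒> y+Δ≰x))))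
      (subst (suc y N.≤_) (NP.+-comm Δ (suc y ∸ Δ)) (NP.m≤n+m∸n (suc y) Δ))
    R : Exchange f (suc x ∸ Δ) (suc y ∸ Δ) A B
    R = exchange f A B pA pB tails-close (N.s≤s⁻¹ lt)
    module R = Exchange R
    regroup : ∀ (a b c e : ℤ) → (a Z.+ c) Z.+ (b Z.+ e) ≡ (a Z.+ b) Z.+ (c Z.+ e)
    regroup = solve-∀
    interleave : ∀ (a b c e : ℤ) → (a Z.+ b) Z.+ (c Z.+ e) ≡ (b Z.+ c) Z.+ (a Z.+ e)
    interleave = solve-∀

  -- Every decreasing list of positions below i; in particular every packing of [0,i).
  candidates : ℕ → List (List ℕ)
  candidates zero    = [] ∷ []
  candidates (suc i) = candidates i ++ map (i ∷_) (candidates i)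

  candidates-complete : ∀ i xs → Packing i xs → xs ∈ candidates i
  candidates-complete zero    []       _ = here refl
  candidates-complete zero    (x ∷ xs) (() , _)
  candidates-complete (suc i) []       _ = ∈-++⁺ˡ (candidates-complete i [] tt)
  candidates-complete (suc i) (x ∷ xs) (x<1+i , p) with x N.≟ i
  ... | yes refl = ∈-++⁺ʳ (candidates x) (∈-map⁺ (x ∷_) (candidates-complete x xs (packing-mono xs (below-next x) p)))
  ... | no  x≢i  = ∈-++⁺ˡ (candidates-complete i (x ∷ xs) (NP.≤∧≢⇒< (N.s≤s⁻¹ x<1+i) x≢i , p))

  maximise : ∀ i {Q : List ℕ → Set} → (∀ xs → Dec (Q xs)) → (f : List ℕ → ℤ) →
    ∀ {xs₀} → Packing i xs₀ → Q xs₀ →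
    Σ (List ℕ) λ xs → (Packing i xs × Q xs) × (∀ ys → Packing i ys → Q ys → f ys Z.≤ f xs)
  maximise i {Q} Q? f {xs₀} p₀ q₀ =
      argmax f xs₀ admissible
    , argmax-all f (p₀ , q₀) (all-filter admissible? (candidates i))
    , λ ys p q → lookup (f[xs]≤f[argmax] xs₀ admissible) (∈-filter⁺ admissible? (candidates-complete i ys p) (p , q))
    where
    admissible? : ∀ xs → Dec (Packing i xs × Q xs)
    admissible? xs = packing? i xs ×-dec Q? xs
    admissible : List (List ℕ)
    admissible = filter admissible? (candidates i)

  best : ∀ i (f : List ℕ → ℤ) → Σ (List ℕ) λ xs → Packing i xs × (∀ ys → Packing i ys → f ys Z.≤ f xs)
  best i f with maximise i {λ _ → ⊤} (λ _ → yes tt) f {[]} tt tt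
  ... | xs , (p , _) , max = xs , p , λ ys q → max ys q tt

  maxSize : ℕ → ℕ
  maxSize i = length (proj₁ (best i (λ xs → + length xs)))

  maxSize-ub : ∀ i xs → Packing i xs → length xs N.≤ maxSize i
  maxSize-ub i xs p = ZP.drop‿+≤+ (proj₂ (proj₂ (best i (λ ys → + length ys))) xs p)

  -- A largest packing of [0, suc n ∸ Δ) extends by position n.
  maxSize-step : ∀ n → suc (maxSize (suc n ∸ Δ)) N.≤ maxSize (suc n)
  maxSize-step n = maxSize-ub (suc n) (n ∷ proj₁ opt) (NP.≤-refl , proj₁ (proj₂ opt))
    where opt = best (suc n ∸ Δ) (λ xs → + length xs)

  -- Dropping leading positions gives packings of every smaller size.
  shrink : ∀ {i} κ xs → Packing i xs → κ N.≤ length xs → Σ (List ℕ) λ ys → Packing i ys × length ys ≡ κ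
  shrink κ xs p κ≤ with κ N.≟ length xs
  ... | yes refl = xs , p , refl
  shrink κ []       p κ≤ | no κ≢ = ⊥-elim (κ≢ (NP.n≤0⇒n≡0 κ≤))
  shrink κ (x ∷ xs) p κ≤ | no κ≢ = shrink κ xs (packing-tail x xs p) (N.s≤s⁻¹ (NP.≤∧≢⇒< κ≤ κ≢))

  bestOfSize : ∀ i κ → κ N.≤ maxSize i → (f : List ℕ → ℤ) →
    Σ (List ℕ) λ xs → (Packing i xs × length xs ≡ κ) × (∀ ys → Packing i ys → length ys ≡ κ → f ys Z.≤ f xs)
  bestOfSize i κ κ≤M f with shrink κ largest (proj₁ (proj₂ (best i (λ xs → + length xs)))) κ≤M
    where largest = proj₁ (best i (λ xs → + length xs))
  ... | xs₀ , p₀ , l₀ = maximise i (λ xs → length xs N.≟ κ) f p₀ l₀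

-- Primal side: the window constraints force k to be a feasible packing size.
module PrimalBound {d Δ : ℕ} (Δ≥1 : Δ ≥ 1) {k : ℤ} {u : Fin d → ℚ} (feasible : PFeasible d Δ k u) where
  open Packings Δ Δ≥1
  open Windows Δ

  g : ℕ → ℚ
  g = extend 0ℚ u

  u≡g : ∀ j → u j ≡ g (toℕ j)
  u≡g j = sym (extend-toℕ 0ℚ u j)

  g≥0 : ∀ n → 0ℚ Q.≤ g n
  g≥0 = extend-all (0ℚ Q.≤_) QP.≤-refl (proj₂ (proj₂ feasible))

  window-bound : ∀ (i : Fin d) {n} → n N.≤ d → n N.≤ toℕ i N.+ Δ → psum n g Q.≤ 1ℚ Q.+ psum (toℕ i) g
  window-bound i {n} n≤d n≤i+Δ = begin
    psum n g                                     ≤⟨ psum-mono g g≥0 (NP.⊓-glb n≤d n≤i+Δ) ⟩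
    psum (d ⊓ (toℕ i N.+ Δ)) g                   ≡⟨ sym (window-sum i u g u≡g) ⟩
    sumWhere (inWindow Δ i) u Q.+ psum (toℕ i) g ≤⟨ QP.+-monoˡ-≤ (psum (toℕ i) g) (proj₁ (proj₂ feasible) i) ⟩
    1ℚ Q.+ psum (toℕ i) g                        ∎
    where open QP.≤-Reasoning

  -- u₀ + … + u_{n−1} is at most the largest size of a packing of [0,n);
  -- induction along n ↦ n + 1 − Δ, bounded by the fuel.
  prefix-bound : ∀ fuel n → n N.≤ fuel → n N.≤ d → psum n g Q.≤ ι (+ maxSize n)
  prefix-bound fuel       zero    _            _   = ι-mono {+ 0} {+ maxSize 0} (+≤+ z≤n)
  prefix-bound (suc fuel) (suc n) (s≤s n≤fuel) n<d = begin
    psum (suc n) g                ≤⟨ window-bound i n<d (subst (λ t → suc n N.≤ t N.+ Δ) (sym i≡l) n<l+Δ) ⟩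
    1ℚ Q.+ psum (toℕ i) g         ≡⟨ cong (λ t → 1ℚ Q.+ psum t g) i≡l ⟩
    1ℚ Q.+ psum l g               ≤⟨ QP.+-monoʳ-≤ 1ℚ (prefix-bound fuel l (NP.≤-trans (below-next n) n≤fuel) (NP.<⇒≤ l<d)) ⟩
    1ℚ Q.+ ι (+ maxSize l)        ≡⟨ sym (ι-+ (+ 1) (+ maxSize l)) ⟩
    ι (+ suc (maxSize l))         ≤⟨ ι-mono (+≤+ (maxSize-step n)) ⟩
    ι (+ maxSize (suc n))         ∎
    where
    open QP.≤-Reasoning
    l : ℕ
    l = suc n ∸ Δ
    l<d : l N.< d
    l<d = NP.≤-trans (s≤s (below-next n)) n<d
    i = proj₁ (position l l<d)
    i≡l = proj₂ (position l l<d)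
    n<l+Δ : suc n N.≤ l N.+ Δ
    n<l+Δ = subst (suc n N.≤_) (NP.+-comm Δ l) (NP.m≤n+m∸n (suc n) Δ)

  sum≡k : ι k ≡ psum d g
  sum≡k = trans (sym (proj₁ feasible)) (sumℚ≡psum u g u≡g)

  primal-size : Σ ℕ λ m → k ≡ + m × m N.≤ maxSize d
  primal-size = bounded-nat
    (ι-cancel-≤ (subst (0ℚ Q.≤_) (sym sum≡k) (psum-nonneg g g≥0 d)))
    (ι-cancel-≤ (subst (Q._≤ ι (+ maxSize d)) (sym sum≡k) (prefix-bound d d NP.≤-refl NP.≤-refl)))

-- Lagrange multipliers for the best packing of a prescribed size.
module Lagrange (Δ : ℕ) (Δ≥1 : Δ ≥ 1) (n : ℕ) (cost : ℕ → ℤ) where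
  open Packings Δ Δ≥1

  reduced : ℤ → ℕ → ℤ
  reduced μ x = cost x Z.- μ

  weight-reduced : ∀ μ xs → weight (reduced μ) xs ≡ weight cost xs Z.- μ Z.* + length xs
  weight-reduced μ []       = zero-length μ
    where
    zero-length : ∀ (a : ℤ) → + 0 ≡ + 0 Z.- a Z.* + 0
    zero-length = solve-∀
  weight-reduced μ (x ∷ xs) = begin
    (cost x Z.- μ) Z.+ weight (reduced μ) xs                    ≡⟨ cong (λ t → (cost x Z.- μ) Z.+ t) (weight-reduced μ xs) ⟩
    (cost x Z.- μ) Z.+ (weight cost xs Z.- μ Z.* + length xs)   ≡⟨ collect (cost x) (weight cost xs) μ (+ length xs) ⟩
    (cost x Z.+ weight cost xs) Z.- μ Z.* (+ 1 Z.+ + length xs) ∎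
    where
    open ≡-Reasoning
    collect : ∀ (a b c L : ℤ) → (a Z.- c) Z.+ (b Z.- c Z.* L) ≡ (a Z.+ b) Z.- c Z.* (+ 1 Z.+ L)
    collect = solve-∀

  -- Concavity at work: if the f-best packings of sizes κ and κ + 1 have equal
  -- f-weight, then no packing of any size has larger f-weight.
  module Flat (f : ℕ → ℤ) {κ : ℕ} {t₀ t₁ : List ℕ}
              (t₀-packing : Packing n t₀) (t₀-length : length t₀ ≡ κ)
              (t₁-packing : Packing n t₁) (t₁-length : length t₁ ≡ suc κ)
              (level : weight f t₁ ≡ weight f t₀)
              (best₀ : ∀ S → Packing n S → length S ≡ κ → weight f S Z.≤ weight f t₀)
              (best₁ : ∀ S → Packing n S → length S ≡ suc κ → weight f S Z.≤ weight f t₀) where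

    exchange-within : ∀ A B → Packing n A → Packing n B → length B N.< length A → Exchange f n n A B
    exchange-within A B pA pB = exchange f A B pA pB (NP.m≤m+n n Δ)

    -- Larger packings: hand one position to t₀; induction on the excess size.
    above : ∀ e S → Packing n S → length S ≡ suc κ N.+ e → weight f S Z.≤ weight f t₀
    above zero    S p l = best₁ S p (trans l (NP.+-identityʳ (suc κ)))
    above (suc e) S p l =
      two-bounded E.balance (above e E.A′ E.A′-packing A′-length)
                            (best₁ E.B′ E.B′-packing (trans E.B′-length (cong suc t₀-length)))
      where
      E = exchange-within S t₀ p t₀-packing (subst₂ N._<_ (sym t₀-length) (sym l) (s≤s (NP.m≤m+n κ (suc e))))
      module E = Exchange E
      A′-length : length E.A′ ≡ suc κ N.+ e
      A′-length = NP.suc-injective (trans E.A′-length (trans l (NP.+-suc (suc κ) e)))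

    -- Smaller packings: receive one position from t₁; induction on the deficit.
    below : ∀ e S → Packing n S → length S N.+ e ≡ κ → weight f S Z.≤ weight f t₀
    below zero    S p l = best₀ S p (trans (sym (NP.+-identityʳ (length S))) l)
    below (suc e) S p l =
      two-bounded (trans E.balance (trans (cong (Z._+ weight f S) level) (ZP.+-comm (weight f t₀) (weight f S))))
                  (best₀ E.A′ E.A′-packing (NP.suc-injective (trans E.A′-length t₁-length)))
                  (below e E.B′ E.B′-packing (trans (cong (N._+ e) E.B′-length) (trans (sym (NP.+-suc (length S) e)) l)))
      where
      S<t₁ : length S N.< length t₁
      S<t₁ = subst (length S N.<_) (sym t₁-length) (s≤s (subst (length S N.≤_) l (NP.m≤m+n (length S) (suc e))))
      E = exchange-within t₁ S t₁-packing p S<t₁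
      module E = Exchange E

    global : ∀ S → Packing n S → weight f S Z.≤ weight f t₀
    global S p with κ N.<? length S
    ... | yes κ<S = above (length S ∸ suc κ) S p (sym (NP.m+[n∸m]≡n κ<S))
    ... | no  κ≮S = below (κ ∸ length S) S p (NP.m+[n∸m]≡n (NP.≮⇒≥ κ≮S))

  record Multiplier (m : ℕ) : Set where
    field
      μ           : ℤ
      opt         : List ℕ
      opt-packing : Packing n opt
      opt-length  : length opt ≡ m
      opt-best    : ∀ S → Packing n S → weight (reduced μ) S Z.≤ weight (reduced μ) opt

  -- μ = h(κ + 1) − h(κ), the marginal best cost, is a multiplier for sizes κ and κ + 1.
  adjacent-multipliers : ∀ κ → suc κ N.≤ maxSize n → Multiplier κ × Multiplier (suc κ)
  adjacent-multipliers κ κ<M =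
      record { μ = μ ; opt = t₀ ; opt-packing = p₀ ; opt-length = l₀ ; opt-best = Level.global }
    , record { μ = μ ; opt = t₁ ; opt-packing = p₁ ; opt-length = l₁
             ; opt-best = λ S p → ZP.≤-trans (Level.global S p) (ZP.≤-reflexive (sym level)) }
    where
    B₀ = bestOfSize n κ (NP.<⇒≤ κ<M) (weight cost)
    B₁ = bestOfSize n (suc κ) κ<M (weight cost)
    t₀ = proj₁ B₀
    t₁ = proj₁ B₁
    p₀ = proj₁ (proj₁ (proj₂ B₀))
    p₁ = proj₁ (proj₁ (proj₂ B₁))
    l₀ = proj₂ (proj₁ (proj₂ B₀))
    l₁ = proj₂ (proj₁ (proj₂ B₁))
    μ : ℤ
    μ = weight cost t₁ Z.- weight cost t₀
    same-size : ∀ {S t} → length S ≡ length t → weight cost S Z.≤ weight cost t →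
                weight (reduced μ) S Z.≤ weight (reduced μ) t
    same-size {S} {t} S≡t S≤t = subst₂ Z._≤_ (sym (trans (weight-reduced μ S) (cong (λ L → weight cost S Z.- μ Z.* + L) S≡t)))
                                             (sym (weight-reduced μ t))
                                             (ZP.+-monoˡ-≤ (Z.- (μ Z.* + length t)) S≤t)
    level : weight (reduced μ) t₁ ≡ weight (reduced μ) t₀
    level = begin
      weight (reduced μ) t₁                                     ≡⟨ weight-reduced μ t₁ ⟩
      weight cost t₁ Z.- μ Z.* + length t₁                      ≡⟨ cong (λ L → weight cost t₁ Z.- μ Z.* + L) (trans l₁ (cong suc (sym l₀))) ⟩
      weight cost t₁ Z.- μ Z.* (+ 1 Z.+ + length t₀)            ≡⟨ marginal (weight cost t₀) (weight cost t₁) (+ length t₀) ⟩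
      weight cost t₀ Z.- μ Z.* + length t₀                      ≡⟨ sym (weight-reduced μ t₀) ⟩
      weight (reduced μ) t₀                                     ∎
      where
      open ≡-Reasoning
      marginal : ∀ (a b L : ℤ) → b Z.- (b Z.- a) Z.* (+ 1 Z.+ L) ≡ a Z.- (b Z.- a) Z.* L
      marginal = solve-∀
    module Level = Flat (reduced μ) p₀ l₀ p₁ l₁ level
      (λ S p l → same-size {S} {t₀} (trans l (sym l₀)) (proj₂ (proj₂ B₀) S p l))
      (λ S p l → ZP.≤-trans (same-size {S} {t₁} (trans l (sym l₁)) (proj₂ (proj₂ B₁) S p l)) (ZP.≤-reflexive level))

  multiplier : ∀ m → m N.≤ maxSize n → Multiplier m
  multiplier (suc κ) κ<M = proj₂ (adjacent-multipliers κ κ<M)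
  multiplier zero    _   with 1 N.≤? maxSize n
  ... | yes 0<M = proj₁ (adjacent-multipliers 0 0<M)
  ... | no  0≮M = record { μ = + 0 ; opt = [] ; opt-packing = tt ; opt-length = refl ; opt-best = only-empty }
    where
    -- all packings are empty
    only-empty : ∀ S → Packing n S → weight (reduced (+ 0)) S Z.≤ + 0
    only-empty []      _ = ZP.≤-refl
    only-empty (x ∷ S) p = ⊥-elim (0≮M (NP.≤-trans (s≤s z≤n) (maxSize-ub n (x ∷ S) p)))

-- Dual side: weak duality and the integral dual certificate.
module DualCertificate (d Δ : ℕ) (Δ≥1 : Δ ≥ 1) (c : Fin d → ℤ) where
  open Packings Δ Δ≥1
  open Windows Δ

  cost : ℕ → ℤ
  cost = extend (+ 0) c

  open Lagrange Δ Δ≥1 d cost public using (Multiplier; multiplier)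
  open Lagrange Δ Δ≥1 d cost using (reduced; weight-reduced)

  -- Weak duality: along a packing the covering windows are disjoint, so summing
  -- the dual constraints at its positions bounds its cost by the dual objective.
  module WeakDuality {v₀ : ℚ} {v : Fin d → ℚ} (dual : DFeasible d Δ c v₀ v) where
    g : ℕ → ℚ
    g = extend 0ℚ v

    v≡g : ∀ j → v j ≡ g (toℕ j)
    v≡g j = sym (extend-toℕ 0ℚ v j)

    g≥0 : ∀ n → 0ℚ Q.≤ g n
    g≥0 = extend-all (0ℚ Q.≤_) QP.≤-refl (proj₂ dual)

    packing-bound : ∀ L {n} → n N.≤ d → Packing n L →
      ι (weight cost L) Q.≤ v₀ Q.* ι (+ length L) Q.+ psum n g
    packing-bound [] {n} _ _ =
      subst (0ℚ Q.≤_) (sym (trans (cong (Q._+ psum n g) (QP.*-zeroʳ v₀)) (QP.+-identityˡ (psum n g))))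
            (psum-nonneg g g≥0 n)
    packing-bound (x ∷ L) {n} n≤d (x<n , p) with position x (NP.≤-trans x<n n≤d)
    ... | i , refl = begin
      ι (cost (toℕ i) Z.+ weight cost L)                    ≡⟨ trans (ι-+ (cost (toℕ i)) (weight cost L))
                                                                     (cong (λ z → ι z Q.+ ι (weight cost L)) (extend-toℕ (+ 0) c i)) ⟩
      ι (c i) Q.+ ι (weight cost L)                         ≤⟨ QP.+-mono-≤ (proj₁ dual i) (packing-bound L l≤d p) ⟩
      (v₀ Q.+ C) Q.+ (v₀ Q.* ι (+ length L) Q.+ psum l g)   ≡⟨ regroup v₀ C (ι (+ length L)) (psum l g) ⟩
      v₀ Q.* (1ℚ Q.+ ι (+ length L)) Q.+ (C Q.+ psum l g)   ≡⟨ cong₂ (λ a b → v₀ Q.* a Q.+ b) (sym (ι-+ (+ 1) (+ length L))) (cover-sum i v g v≡g) ⟩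
      v₀ Q.* ι (+ suc (length L)) Q.+ psum (suc (toℕ i)) g ≤⟨ QP.+-monoʳ-≤ (v₀ Q.* ι (+ suc (length L))) (psum-mono g g≥0 x<n) ⟩
      v₀ Q.* ι (+ suc (length L)) Q.+ psum n g              ∎
      where
      open QP.≤-Reasoning
      open +-*-Solver
      C : ℚ
      C = sumWhere (λ j → inWindow Δ j i) v
      l : ℕ
      l = suc (toℕ i) ∸ Δ
      l≤d : l N.≤ d
      l≤d = NP.≤-trans (below-next (toℕ i)) (NP.≤-trans (NP.<⇒≤ x<n) n≤d)
      regroup : ∀ a b e s → (a Q.+ b) Q.+ (a Q.* e Q.+ s) ≡ a Q.* (1ℚ Q.+ e) Q.+ (b Q.+ s)
      regroup = solve 4 (λ a b e s → (a :+ b) :+ (a :* e :+ s) := a :* (con 1ℚ :+ e) :+ (b :+ s)) refl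

    dual-lower : ∀ S → Packing d S → ι (weight cost S) Q.≤ DObj d (+ length S) v₀ v
    dual-lower S p = subst (λ t → ι (weight cost S) Q.≤ v₀ Q.* ι (+ length S) Q.+ t)
                           (sym (sumℚ≡psum v g v≡g)) (packing-bound S NP.≤-refl p)

  -- From a multiplier μ for size m: w₀ = μ and w_j = W(j + 1) − W(j).
  module Certificate {m : ℕ} (M : Multiplier m) where
    open Multiplier M

    bestPacking : ℕ → List ℕ
    bestPacking n = proj₁ (best n (weight (reduced μ)))

    bestPacking-packing : ∀ n → Packing n (bestPacking n)
    bestPacking-packing n = proj₁ (proj₂ (best n (weight (reduced μ))))

    W : ℕ → ℤ
    W n = weight (reduced μ) (bestPacking n)

    W-ub : ∀ n S → Packing n S → weight (reduced μ) S Z.≤ W n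
    W-ub n = proj₂ (proj₂ (best n (weight (reduced μ))))

    W-zero : W 0 ≡ + 0
    W-zero = only-empty (bestPacking 0) (bestPacking-packing 0)
      where
      only-empty : ∀ S → Packing 0 S → weight (reduced μ) S ≡ + 0
      only-empty []      _        = refl
      only-empty (x ∷ S) (() , _)

    W-mono : ∀ n → W n Z.≤ W (suc n)
    W-mono n = W-ub (suc n) (bestPacking n) (packing-mono (bestPacking n) (NP.n≤1+n n) (bestPacking-packing n))

    -- Bellman inequality: position n extends a best packing of [0, n + 1 − Δ).
    W-step : ∀ n → reduced μ n Z.+ W (suc n ∸ Δ) Z.≤ W (suc n)
    W-step n = W-ub (suc n) (n ∷ bestPacking (suc n ∸ Δ)) (NP.≤-refl , bestPacking-packing (suc n ∸ Δ))

    -- Since opt is best among all packings, it attains W d.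
    W-final : W d ≡ weight (reduced μ) opt
    W-final = ZP.≤-antisym (opt-best (bestPacking d) (bestPacking-packing d)) (W-ub d opt opt-packing)

    increment : ℕ → ℚ
    increment i = ι (W (suc i) Z.- W i)

    w : Fin d → ℚ
    w j = increment (toℕ j)

    psum-increment : ∀ n → psum n increment ≡ ι (W n)
    psum-increment = ι-telescope W W-zero

    w-nonneg : ∀ j → 0ℚ Q.≤ w j
    w-nonneg j = ι-mono (ZP.i≤j⇒0≤j-i (W-mono (toℕ j)))

    -- The dual constraint at i is the Bellman inequality at position i.
    w-covers : ∀ i → ι (c i) Q.≤ ι μ Q.+ sumWhere (λ j → inWindow Δ j i) w
    w-covers i = +-cancelʳ-≤ (ι (W l)) (begin
      ι (c i) Q.+ ι (W l)       ≡⟨ sym (ι-+ (c i) (W l)) ⟩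
      ι (c i Z.+ W l)           ≤⟨ ι-mono bellman ⟩
      ι (μ Z.+ W (suc x))       ≡⟨ ι-+ μ (W (suc x)) ⟩
      ι μ Q.+ ι (W (suc x))     ≡⟨ cong (ι μ Q.+_) (sym cover) ⟩
      ι μ Q.+ (C Q.+ ι (W l))   ≡⟨ sym (QP.+-assoc (ι μ) C (ι (W l))) ⟩
      (ι μ Q.+ C) Q.+ ι (W l)   ∎)
      where
      open QP.≤-Reasoning
      x l : ℕ
      x = toℕ i
      l = suc x ∸ Δ
      C : ℚ
      C = sumWhere (λ j → inWindow Δ j i) w
      cover : C Q.+ ι (W l) ≡ ι (W (suc x))
      cover = trans (cong (C Q.+_) (sym (psum-increment l)))
                    (trans (cover-sum i w increment (λ _ → refl)) (psum-increment (suc x)))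
      shift : ∀ (a b e : ℤ) → ((a Z.- b) Z.+ e) Z.+ b ≡ a Z.+ e
      shift = solve-∀
      bellman : c i Z.+ W l Z.≤ μ Z.+ W (suc x)
      bellman = subst₂ Z._≤_ (trans (shift (cost x) μ (W l)) (cong (Z._+ W l) (extend-toℕ (+ 0) c i)))
                             (ZP.+-comm (W (suc x)) μ)
                             (ZP.+-monoˡ-≤ μ (W-step x))

    objective : DObj d (+ m) (ι μ) w ≡ ι (weight cost opt)
    objective = begin
      ι μ Q.* ι (+ m) Q.+ sumℚ w  ≡⟨ cong (ι μ Q.* ι (+ m) Q.+_) (trans (sumℚ≡psum w increment (λ _ → refl)) (psum-increment d)) ⟩
      ι μ Q.* ι (+ m) Q.+ ι (W d) ≡⟨ sym (trans (ι-+ (μ Z.* + m) (W d)) (cong (Q._+ ι (W d)) (ι-* μ (+ m)))) ⟩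
      ι (μ Z.* + m Z.+ W d)       ≡⟨ cong (λ z → ι (μ Z.* + m Z.+ z)) (trans W-final (weight-reduced μ opt)) ⟩
      ι (μ Z.* + m Z.+ (weight cost opt Z.- μ Z.* + length opt)) ≡⟨ cong (λ L → ι (μ Z.* + m Z.+ (weight cost opt Z.- μ Z.* + L))) opt-length ⟩
      ι (μ Z.* + m Z.+ (weight cost opt Z.- μ Z.* + m))         ≡⟨ cong ι (cancel (μ Z.* + m) (weight cost opt)) ⟩
      ι (weight cost opt)         ∎
      where
      open ≡-Reasoning
      cancel : ∀ (a b : ℤ) → a Z.+ (b Z.- a) ≡ b
      cancel = solve-∀

    optimal : DOptimal d Δ (+ m) c (ι μ) w
    optimal = (w-covers , w-nonneg) , λ v₀ v dual →
      subst₂ Q._≤_ (sym objective) (cong (λ L → DObj d (+ L) v₀ v) opt-length)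
             (WeakDuality.dual-lower {v₀} {v} dual opt opt-packing)

corollary2 : (d Δ : ℕ) → Δ ≥ 1 → (k : ℤ) → (c : Fin d → ℤ) →
    Σ (Fin d → ℚ) (λ u → PFeasible d Δ k u) →
    Σ ℚ (λ w₀ → Σ (Fin d → ℚ) (λ w → DOptimal d Δ k c w₀ w × Σ ℤ (λ z → w₀ ≡ ι z)))
corollary2 d Δ Δ≥1 k c (u , feasible) with PrimalBound.primal-size {d} {Δ} Δ≥1 {k} {u} feasible
... | m , refl , m≤M = ι μ , w , optimal , μ , refl
  where
  open DualCertificate d Δ Δ≥1 c
  M : Multiplier m
  M = multiplier m m≤M
  open Multiplier M using (μ)
  open Certificate M using (w; optimal)
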